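{- For every integer $n\ge 0$, $$E_n = \sum_{k=0}^n S(n,k)\, k!\, (-1)^k \left\{\sum_{j=0}^k \binom{2j}{j}\frac{1}{2^{k+j}(1-2j)}\right\}.$$
   Context: $S(n,k)$ are the Stirling numbers of the second kind. The Euler polynomials $E_n(x)$ are defined by $\frac{2e^{xt}}{e^t+1} = \sum_{n\ge0} E_n(x)\frac{t^n}{n!}$, and here the Euler numbers are defined as $E_n = E_n(1/2)$. -}

module Defs where

open import Data.Nat as ℕ using (ℕ; zero; suc)
open import Data.Nat.Combinatorics using (_C_)
open import Data.Integer as ℤ using (ℤ; +_; -[1+_])
open import Data.Rational using (ℚ; _+_; _*_; _-_; -_; _/_; 0ℚ; 1ℚ; ½)
open import Data.Vec as Vec using (Vec; []; _∷_; lookup; _∷ʳ_)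
open import Data.Fin using (Fin; fromℕ; inject₁; toℕ)

ℕ→ℚ : ℕ → ℚ
ℕ→ℚ n = + n / 1

_^q_ : ℚ → ℕ → ℚ
x ^q zero = 1ℚ
x ^q suc n = x * (x ^q n)

sgn : ℕ → ℚ
sgn k = (- 1ℚ) ^q k

sumTo : ℕ → (ℕ → ℚ) → ℚ
sumTo zero f = f zero
sumTo (suc n) f = sumTo n f + f (suc n)

sumFin : (n : ℕ) → (Fin n → ℚ) → ℚ
sumFin zero f = 0ℚ
sumFin (suc n) f = sumFin n (λ i → f (inject₁ i)) + f (fromℕ n)

S : ℕ → ℕ → ℕ
S zero zero = 1
S zero (suc k) = 0
S (suc n) zero = 0
S (suc n) (suc k) = suc k ℕ.* S n (suc k) ℕ.+ S n k

-- Euler polynomials E_n(x), defined by 2e^{xt}/(e^t+1) = Σ E_n(x) t^n/n!.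
-- Comparing coefficients of t^n/n! in (e^t + 1) Σ E_k(x) t^k/k! = 2 e^{xt}
-- gives  Σ_{k=0}^{n} C(n,k) E_k(x) + E_n(x) = 2 x^n, i.e.
--   E_n(x) = x^n - ½ Σ_{k=0}^{n-1} C(n,k) E_k(x).
-- eulerPolys x n is the vector (E_0(x), …, E_n(x)).
eulerPolys : ℚ → (n : ℕ) → Vec ℚ (suc n)
eulerPolys x zero = 1ℚ ∷ []
eulerPolys x (suc n) = prev ∷ʳ new
  where
  prev = eulerPolys x n
  new = (x ^q suc n) - ½ * sumFin (suc n) (λ k → ℕ→ℚ (suc n C toℕ k) * lookup prev k)

eulerPoly : ℕ → ℚ → ℚ
eulerPoly n x = lookup (eulerPolys x n) (fromℕ n)

-- Euler numbers as in the paper: E_n = E_n(1/2).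
E : ℕ → ℚ
E n = eulerPoly n ½

-- 1/(1-2j): for j = 0 this is 1; for j = i+1 it is -1/(2i+1).
inv1m2j : ℕ → ℚ
inv1m2j zero = 1ℚ
inv1m2j (suc i) = -[1+ 0 ] / suc (i ℕ.+ i)

term : ℕ → ℕ → ℚ
term k j = ℕ→ℚ ((2 ℕ.* j) C j) * (½ ^q (k ℕ.+ j)) * inv1m2j j

-- Put g(u) = Σₖ A(k) uᵏ/k!, so that Σₖ S(n,k) A(k) is the coefficient of tⁿ/n! in g(eᵗ − 1).
-- Whenever (2 + u) g(u) = 2 (1 + u)ˣ, the series g(eᵗ − 1) satisfies (eᵗ + 1) g(eᵗ − 1) = 2 eˣᵗ,
-- the equation defining the Euler polynomials, so its coefficients are Eₙ(x).  For x = ½ the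
-- solution is g(u) = √(1 + u) / (1 + u/2); multiplying the binomial series of √(1 + u) by the
-- geometric series of 1 / (1 + u/2) gives A(k) = k! (−1)ᵏ Σⱼ C(2j,j) / (2^(k+j) (1 − 2j)).
module Submission where

open import Defs
open import Data.Nat as ℕ using (ℕ; zero; suc; _!)
import Data.Nat.Properties as ℕ
import Data.Nat.Coprimality as Coprime
open import Data.Nat.Combinatorics
  using (_C_; nCn≡1; nC1≡n; nCk≡nC[n∸k]; nCk+nC[k+1]≡[n+1]C[k+1]; k>n⇒nCk≡0)
import Data.Nat.Tactic.RingSolver as ℕ-Solver
import Data.Integer as ℤ
import Data.Integer.Properties as ℤ
open import Data.Rational using (ℚ; _+_; _*_; _-_; -_; 0ℚ; 1ℚ; ½; toℚᵘ; normalize; 1/_; mkℚ)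
open import Data.Rational.Properties
import Data.Rational.Unnormalised as ℚᵘ
import Data.Rational.Unnormalised.Properties as ℚᵘ
open import Data.Fin as Fin using (Fin; toℕ; fromℕ; inject₁)
open import Data.Fin.Properties using (toℕ-inject₁; toℕ-fromℕ)
open import Data.Vec using (Vec; []; _∷_; _∷ʳ_; lookup; tabulate)
open import Data.Vec.Properties using (lookup∘tabulate; tabulate-cong)
open import Function using (_∘_)
open import Relation.Binary.PropositionalEquality
open import Relation.Nullary.Decidable using (dec⇒maybe)
open import Tactic.RingSolver using (solve-∀)
open import Tactic.RingSolver.Core.AlmostCommutativeRing using (AlmostCommutativeRing; fromCommutativeRing)

ℚ-ring : AlmostCommutativeRing _ _
ℚ-ring = fromCommutativeRing +-*-commutativeRing (λ x → dec⇒maybe (0ℚ ≟ x))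

ℕ→ℚ-suc : ∀ n → ℕ→ℚ (suc n) ≡ 1ℚ + ℕ→ℚ n
ℕ→ℚ-suc n = toℚᵘ-injective (begin
  toℚᵘ (ℕ→ℚ (suc n))          ≈⟨ toℚᵘ-fromℚᵘ [1+n] ⟩
  [1+n]                       ≈⟨ ℚᵘ.≃-reflexive (cong (λ i → ℚᵘ.mkℚᵘ i 0) 1+n≡1*1+n*1) ⟩
  toℚᵘ 1ℚ ℚᵘ.+ [n]            ≈⟨ ℚᵘ.+-congʳ (toℚᵘ 1ℚ) (toℚᵘ-fromℚᵘ [n]) ⟨
  toℚᵘ 1ℚ ℚᵘ.+ toℚᵘ (ℕ→ℚ n)   ≈⟨ toℚᵘ-homo-+ 1ℚ (ℕ→ℚ n) ⟨
  toℚᵘ (1ℚ + ℕ→ℚ n)           ∎)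
  where
  open ℚᵘ.≃-Reasoning
  [n] [1+n] : ℚᵘ.ℚᵘ
  [n] = ℚᵘ.mkℚᵘ (ℤ.+ n) 0
  [1+n] = ℚᵘ.mkℚᵘ (ℤ.+ suc n) 0
  1+n≡1*1+n*1 : ℤ.+ suc n ≡ ℤ.1ℤ ℤ.* ℤ.1ℤ ℤ.+ ℤ.+ n ℤ.* ℤ.1ℤ
  1+n≡1*1+n*1 = cong (ℤ._+_ ℤ.1ℤ) (sym (ℤ.*-identityʳ (ℤ.+ n)))

ℕ→ℚ-+ : ∀ m n → ℕ→ℚ (m ℕ.+ n) ≡ ℕ→ℚ m + ℕ→ℚ n
ℕ→ℚ-+ zero    n = sym (+-identityˡ (ℕ→ℚ n))
ℕ→ℚ-+ (suc m) n = begin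
  ℕ→ℚ (suc (m ℕ.+ n))     ≡⟨ ℕ→ℚ-suc (m ℕ.+ n) ⟩
  1ℚ + ℕ→ℚ (m ℕ.+ n)      ≡⟨ cong (1ℚ +_) (ℕ→ℚ-+ m n) ⟩
  1ℚ + (ℕ→ℚ m + ℕ→ℚ n)    ≡⟨ sym (+-assoc 1ℚ (ℕ→ℚ m) (ℕ→ℚ n)) ⟩
  1ℚ + ℕ→ℚ m + ℕ→ℚ n      ≡⟨ cong (_+ ℕ→ℚ n) (sym (ℕ→ℚ-suc m)) ⟩
  ℕ→ℚ (suc m) + ℕ→ℚ n     ∎
  where open ≡-Reasoning

ℕ→ℚ-* : ∀ m n → ℕ→ℚ (m ℕ.* n) ≡ ℕ→ℚ m * ℕ→ℚ n
ℕ→ℚ-* zero    n = sym (*-zeroˡ (ℕ→ℚ n))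
ℕ→ℚ-* (suc m) n = begin
  ℕ→ℚ (n ℕ.+ m ℕ.* n)      ≡⟨ ℕ→ℚ-+ n (m ℕ.* n) ⟩
  ℕ→ℚ n + ℕ→ℚ (m ℕ.* n)    ≡⟨ cong (ℕ→ℚ n +_) (ℕ→ℚ-* m n) ⟩
  ℕ→ℚ n + ℕ→ℚ m * ℕ→ℚ n    ≡⟨ distrib (ℕ→ℚ n) (ℕ→ℚ m) ⟩
  (1ℚ + ℕ→ℚ m) * ℕ→ℚ n     ≡⟨ cong (_* ℕ→ℚ n) (sym (ℕ→ℚ-suc m)) ⟩
  ℕ→ℚ (suc m) * ℕ→ℚ n      ∎
  where
  open ≡-Reasoning
  distrib : ∀ a b → a + b * a ≡ (1ℚ + b) * a
  distrib = solve-∀ ℚ-ring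

sumTo-cong : ∀ n {f g : ℕ → ℚ} → (∀ k → f k ≡ g k) → sumTo n f ≡ sumTo n g
sumTo-cong zero    f≗g = f≗g zero
sumTo-cong (suc n) f≗g = cong₂ _+_ (sumTo-cong n f≗g) (f≗g (suc n))

sumTo-+ : ∀ n (f g : ℕ → ℚ) → sumTo n (λ k → f k + g k) ≡ sumTo n f + sumTo n g
sumTo-+ zero    f g = refl
sumTo-+ (suc n) f g =
  trans (cong (_+ (f (suc n) + g (suc n))) (sumTo-+ n f g))
        (interchange (sumTo n f) (sumTo n g) (f (suc n)) (g (suc n)))
  where
  interchange : ∀ a b c d → a + b + (c + d) ≡ a + c + (b + d)
  interchange = solve-∀ ℚ-ring

*-distribˡ-sumTo : ∀ n c (f : ℕ → ℚ) → sumTo n (λ k → c * f k) ≡ c * sumTo n f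
*-distribˡ-sumTo zero    c f = refl
*-distribˡ-sumTo (suc n) c f =
  trans (cong (_+ c * f (suc n)) (*-distribˡ-sumTo n c f))
        (sym (*-distribˡ-+ c (sumTo n f) (f (suc n))))

sumTo-suc : ∀ n (f : ℕ → ℚ) → sumTo (suc n) f ≡ f 0 + sumTo n (f ∘ suc)
sumTo-suc zero    f = refl
sumTo-suc (suc n) f = trans (cong (_+ f (suc (suc n))) (sumTo-suc n f)) (+-assoc (f 0) _ _)

sumTo-suc-vanishing : ∀ n (f : ℕ → ℚ) → f (suc n) ≡ 0ℚ → sumTo (suc n) f ≡ sumTo n f
sumTo-suc-vanishing n f f[1+n]≡0 = trans (cong (sumTo n f +_) f[1+n]≡0) (+-identityʳ (sumTo n f))

binomialSum : ℕ → (ℕ → ℚ) → ℚ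
binomialSum n B = sumTo n (λ m → ℕ→ℚ (n C m) * B m)

binomialSum-suc : ∀ n (B : ℕ → ℚ) →
                  binomialSum (suc n) B ≡ binomialSum n B + binomialSum n (B ∘ suc)
binomialSum-suc n B = begin
  binomialSum (suc n) B
    ≡⟨ sumTo-suc n _ ⟩
  h 0 + sumTo n (λ m → ℕ→ℚ (suc n C suc m) * B (suc m))
    ≡⟨ cong (h 0 +_) (trans (sumTo-cong n pascal) (sumTo-+ n (h ∘ suc) _)) ⟩
  h 0 + (sumTo n (h ∘ suc) + B′)
    ≡⟨ sym (+-assoc (h 0) _ B′) ⟩
  h 0 + sumTo n (h ∘ suc) + B′
    ≡⟨ cong (_+ B′) (trans (sym (sumTo-suc n h)) (sumTo-suc-vanishing n h h[1+n]≡0)) ⟩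
  binomialSum n B + B′
    ∎
  where
  open ≡-Reasoning
  h : ℕ → ℚ
  h m = ℕ→ℚ (n C m) * B m
  B′ = binomialSum n (B ∘ suc)
  pascal : ∀ m → ℕ→ℚ (suc n C suc m) * B (suc m) ≡ h (suc m) + ℕ→ℚ (n C m) * B (suc m)
  pascal m = begin
    ℕ→ℚ (suc n C suc m) * b
      ≡⟨ cong (λ c → ℕ→ℚ c * b) (sym (nCk+nC[k+1]≡[n+1]C[k+1] n m)) ⟩
    ℕ→ℚ (n C m ℕ.+ n C suc m) * b
      ≡⟨ cong (_* b) (ℕ→ℚ-+ (n C m) (n C suc m)) ⟩
    (ℕ→ℚ (n C m) + ℕ→ℚ (n C suc m)) * b
      ≡⟨ *-distribʳ-+ b (ℕ→ℚ (n C m)) (ℕ→ℚ (n C suc m)) ⟩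
    ℕ→ℚ (n C m) * b + h (suc m)
      ≡⟨ +-comm (ℕ→ℚ (n C m) * b) (h (suc m)) ⟩
    h (suc m) + ℕ→ℚ (n C m) * b
      ∎
    where b = B (suc m)
  h[1+n]≡0 : h (suc n) ≡ 0ℚ
  h[1+n]≡0 = trans (cong (λ c → ℕ→ℚ c * B (suc n)) (k>n⇒nCk≡0 (ℕ.n<1+n n))) (*-zeroˡ (B (suc n)))

-- For F_A(t) = Σₖ A(k) (eᵗ − 1)ᵏ/k! one has F_A′ = F_(D A) and eᵗ F_A = F_(mulOnePlusU A), so that
-- F_A⁽ⁿ⁾(0) = D^ n A 0 and D-mulOnePlusU is the product rule.

D : (ℕ → ℚ) → ℕ → ℚ
D A k = ℕ→ℚ k * A k + A (suc k)

D^ : ℕ → (ℕ → ℚ) → ℕ → ℚ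
D^ zero    A = A
D^ (suc n) A = D^ n (D A)

D^-cong : ∀ n {A B : ℕ → ℚ} → (∀ k → A k ≡ B k) → ∀ k → D^ n A k ≡ D^ n B k
D^-cong zero    A≗B = A≗B
D^-cong (suc n) A≗B = D^-cong n (λ k → cong₂ _+_ (cong (ℕ→ℚ k *_) (A≗B k)) (A≗B (suc k)))

D^-+ : ∀ n (A B : ℕ → ℚ) k → D^ n (λ j → A j + B j) k ≡ D^ n A k + D^ n B k
D^-+ zero    A B k = refl
D^-+ (suc n) A B k =
  trans (D^-cong n (λ j → interchange (ℕ→ℚ j) (A j) (B j) (A (suc j)) (B (suc j))) k)
        (D^-+ n (D A) (D B) k)
  where
  interchange : ∀ a x y z w → a * (x + y) + (z + w) ≡ (a * x + z) + (a * y + w)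
  interchange = solve-∀ ℚ-ring

D^-*ˡ : ∀ n c (A : ℕ → ℚ) k → D^ n (λ j → c * A j) k ≡ c * D^ n A k
D^-*ˡ zero    c A k = refl
D^-*ˡ (suc n) c A k =
  trans (D^-cong n (λ j → factor (ℕ→ℚ j) c (A j) (A (suc j))) k) (D^-*ˡ n c (D A) k)
  where
  factor : ∀ a c x y → a * (c * x) + c * y ≡ c * (a * x + y)
  factor = solve-∀ ℚ-ring

k>n⇒S[n,k]≡0 : ∀ {n k} → k ℕ.> n → S n k ≡ 0
k>n⇒S[n,k]≡0 {zero}  {suc k} _ = refl
k>n⇒S[n,k]≡0 {suc n} {suc k} (ℕ.s≤s k>n)
  rewrite k>n⇒S[n,k]≡0 (ℕ.m<n⇒m<1+n k>n) | k>n⇒S[n,k]≡0 k>n =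
  trans (ℕ.+-identityʳ (k ℕ.* 0)) (ℕ.*-zeroʳ k)

stirlingTransform : ℕ → (ℕ → ℚ) → ℚ
stirlingTransform n A = sumTo n (λ k → ℕ→ℚ (S n k) * A k)

stirlingTransform-suc : ∀ n A → stirlingTransform (suc n) A ≡ stirlingTransform n (D A)
stirlingTransform-suc n A = begin
  stirlingTransform (suc n) A
    ≡⟨ sumTo-suc n _ ⟩
  0ℚ * A 0 + sumTo n (λ k → ℕ→ℚ (S (suc n) (suc k)) * A (suc k))
    ≡⟨ cong₂ _+_ (*-zeroˡ (A 0)) (sumTo-cong n recurrence) ⟩
  0ℚ + sumTo n (λ k → g (suc k) + ℕ→ℚ (S n k) * A (suc k))
    ≡⟨ trans (+-identityˡ _) (sumTo-+ n (g ∘ suc) _) ⟩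
  sumTo n (g ∘ suc) + sumTo n (λ k → ℕ→ℚ (S n k) * A (suc k))
    ≡⟨ cong (_+ sumTo n (λ k → ℕ→ℚ (S n k) * A (suc k))) shift-g ⟩
  sumTo n g + sumTo n (λ k → ℕ→ℚ (S n k) * A (suc k))
    ≡⟨ sym (sumTo-+ n g _) ⟩
  sumTo n (λ k → g k + ℕ→ℚ (S n k) * A (suc k))
    ≡⟨ sumTo-cong n (λ k → collect (ℕ→ℚ k) (ℕ→ℚ (S n k)) (A k) (A (suc k))) ⟩
  stirlingTransform n (D A)
    ∎
  where
  open ≡-Reasoning
  g : ℕ → ℚ
  g k = ℕ→ℚ k * ℕ→ℚ (S n k) * A k
  collect : ∀ a s x y → a * s * x + s * y ≡ s * (a * x + y)
  collect = solve-∀ ℚ-ring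
  recurrence : ∀ k → ℕ→ℚ (S (suc n) (suc k)) * A (suc k) ≡ g (suc k) + ℕ→ℚ (S n k) * A (suc k)
  recurrence k = begin
    ℕ→ℚ (suc k ℕ.* S n (suc k) ℕ.+ S n k) * a
      ≡⟨ cong (_* a) (ℕ→ℚ-+ (suc k ℕ.* S n (suc k)) (S n k)) ⟩
    (ℕ→ℚ (suc k ℕ.* S n (suc k)) + ℕ→ℚ (S n k)) * a
      ≡⟨ cong (λ s → (s + ℕ→ℚ (S n k)) * a) (ℕ→ℚ-* (suc k) (S n (suc k))) ⟩
    (ℕ→ℚ (suc k) * ℕ→ℚ (S n (suc k)) + ℕ→ℚ (S n k)) * a
      ≡⟨ *-distribʳ-+ a (ℕ→ℚ (suc k) * ℕ→ℚ (S n (suc k))) (ℕ→ℚ (S n k)) ⟩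
    g (suc k) + ℕ→ℚ (S n k) * a
      ∎
    where a = A (suc k)
  g0≡0 : g 0 ≡ 0ℚ
  g0≡0 = trans (cong (_* A 0) (*-zeroˡ (ℕ→ℚ (S n 0)))) (*-zeroˡ (A 0))
  g[1+n]≡0 : g (suc n) ≡ 0ℚ
  g[1+n]≡0 = begin
    ℕ→ℚ (suc n) * ℕ→ℚ (S n (suc n)) * A (suc n)
      ≡⟨ cong (λ s → ℕ→ℚ (suc n) * ℕ→ℚ s * A (suc n)) (k>n⇒S[n,k]≡0 (ℕ.n<1+n n)) ⟩
    ℕ→ℚ (suc n) * 0ℚ * A (suc n)
      ≡⟨ trans (cong (_* A (suc n)) (*-zeroʳ (ℕ→ℚ (suc n)))) (*-zeroˡ (A (suc n))) ⟩
    0ℚ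
      ∎
  shift-g : sumTo n (g ∘ suc) ≡ sumTo n g
  shift-g = begin
    sumTo n (g ∘ suc)          ≡⟨ +-identityˡ _ ⟨
    0ℚ + sumTo n (g ∘ suc)     ≡⟨ cong (_+ sumTo n (g ∘ suc)) g0≡0 ⟨
    g 0 + sumTo n (g ∘ suc)    ≡⟨ sumTo-suc n g ⟨
    sumTo (suc n) g            ≡⟨ sumTo-suc-vanishing n g g[1+n]≡0 ⟩
    sumTo n g                  ∎

stirlingTransform≡D^ : ∀ n A → stirlingTransform n A ≡ D^ n A 0
stirlingTransform≡D^ zero    A = *-identityˡ (A 0)
stirlingTransform≡D^ (suc n) A = trans (stirlingTransform-suc n A) (stirlingTransform≡D^ n (D A))

mulOnePlusU : (ℕ → ℚ) → ℕ → ℚ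
mulOnePlusU A zero    = A zero
mulOnePlusU A (suc k) = A (suc k) + ℕ→ℚ (suc k) * A k

D-mulOnePlusU : ∀ A k → D (mulOnePlusU A) k ≡ mulOnePlusU (D A) k + mulOnePlusU A k
D-mulOnePlusU A zero = leibniz₀ (A 0) (A 1)
  where
  leibniz₀ : ∀ a b → 0ℚ * a + (b + 1ℚ * a) ≡ (0ℚ * a + b) + a
  leibniz₀ = solve-∀ ℚ-ring
D-mulOnePlusU A (suc k) rewrite ℕ→ℚ-suc (suc k) | ℕ→ℚ-suc k =
  leibniz (ℕ→ℚ k) (A k) (A (suc k)) (A (suc (suc k)))
  where
  leibniz : ∀ a x y z → (1ℚ + a) * (y + (1ℚ + a) * x) + (z + (1ℚ + (1ℚ + a)) * y)
                      ≡ ((1ℚ + a) * y + z + (1ℚ + a) * (a * x + y)) + (y + (1ℚ + a) * x)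
  leibniz = solve-∀ ℚ-ring

binomialSum-D^ : ∀ n A → binomialSum n (λ m → D^ m A 0) ≡ D^ n (mulOnePlusU A) 0
binomialSum-D^ zero    A = *-identityˡ (A 0)
binomialSum-D^ (suc n) A = begin
  binomialSum (suc n) (λ m → D^ m A 0)
    ≡⟨ binomialSum-suc n _ ⟩
  binomialSum n (λ m → D^ m A 0) + binomialSum n (λ m → D^ m (D A) 0)
    ≡⟨ cong₂ _+_ (binomialSum-D^ n A) (binomialSum-D^ n (D A)) ⟩
  D^ n (mulOnePlusU A) 0 + D^ n (mulOnePlusU (D A)) 0
    ≡⟨ D^-+ n (mulOnePlusU A) (mulOnePlusU (D A)) 0 ⟨
  D^ n (λ j → mulOnePlusU A j + mulOnePlusU (D A) j) 0
    ≡⟨ D^-cong n product-rule 0 ⟩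
  D^ n (D (mulOnePlusU A)) 0
    ∎
  where
  open ≡-Reasoning
  product-rule : ∀ j → mulOnePlusU A j + mulOnePlusU (D A) j ≡ D (mulOnePlusU A) j
  product-rule j = trans (+-comm (mulOnePlusU A j) _) (sym (D-mulOnePlusU A j))

fallingFactorial : ℚ → ℕ → ℚ
fallingFactorial x zero    = 1ℚ
fallingFactorial x (suc k) = fallingFactorial x k * (x - ℕ→ℚ k)

D-fallingFactorial : ∀ x k → D (fallingFactorial x) k ≡ x * fallingFactorial x k
D-fallingFactorial x k = eigen x (ℕ→ℚ k) (fallingFactorial x k)
  where
  eigen : ∀ x a f → a * f + f * (x - a) ≡ x * f
  eigen = solve-∀ ℚ-ring

D^-fallingFactorial : ∀ n x k → D^ n (fallingFactorial x) k ≡ (x ^q n) * fallingFactorial x k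
D^-fallingFactorial zero    x k = sym (*-identityˡ _)
D^-fallingFactorial (suc n) x k = begin
  D^ n (D (fallingFactorial x)) k            ≡⟨ D^-cong n (D-fallingFactorial x) k ⟩
  D^ n (λ j → x * fallingFactorial x j) k    ≡⟨ D^-*ˡ n x (fallingFactorial x) k ⟩
  x * D^ n (fallingFactorial x) k            ≡⟨ cong (x *_) (D^-fallingFactorial n x k) ⟩
  x * ((x ^q n) * fallingFactorial x k)      ≡⟨ *-assoc x (x ^q n) _ ⟨
  (x ^q suc n) * fallingFactorial x k        ∎
  where open ≡-Reasoning

-- The coefficient of tⁿ/n! in (eᵗ + 1) Σₘ U(m) tᵐ/m! = 2 eˣᵗ.
EulerRecurrence : ℚ → (ℕ → ℚ) → Set
EulerRecurrence x U = ∀ n → binomialSum n U + U n ≡ ℕ→ℚ 2 * (x ^q n)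

tabulate-∷ʳ : ∀ {A : Set} n (g : Fin (suc n) → A) →
              tabulate g ≡ tabulate (g ∘ inject₁) ∷ʳ g (fromℕ n)
tabulate-∷ʳ zero    g = refl
tabulate-∷ʳ (suc n) g = cong (g Fin.zero ∷_) (tabulate-∷ʳ n (g ∘ Fin.suc))

sumFin-cong : ∀ n {f g : Fin n → ℚ} → (∀ i → f i ≡ g i) → sumFin n f ≡ sumFin n g
sumFin-cong zero    f≗g = refl
sumFin-cong (suc n) f≗g = cong₂ _+_ (sumFin-cong n (f≗g ∘ inject₁)) (f≗g (fromℕ n))

sumFin≡sumTo : ∀ n (f : ℕ → ℚ) → sumFin (suc n) (f ∘ toℕ) ≡ sumTo n f
sumFin≡sumTo zero    f = +-identityˡ (f 0)
sumFin≡sumTo (suc n) f = cong₂ _+_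
  (trans (sumFin-cong (suc n) (cong f ∘ toℕ-inject₁)) (sumFin≡sumTo n f))
  (cong f (toℕ-fromℕ (suc n)))

module _ (x : ℚ) (U : ℕ → ℚ) (recurrence : EulerRecurrence x U) where

  private
    values : ∀ n → Vec ℚ (suc n)
    values n = tabulate (U ∘ toℕ)

    nextEulerPoly : ∀ n → Vec ℚ (suc n) → ℚ
    nextEulerPoly n prev =
      (x ^q suc n) - ½ * sumFin (suc n) (λ k → ℕ→ℚ (suc n C toℕ k) * lookup prev k)

    solve-for-last : ∀ Y u b → Y + 1ℚ * u + u ≡ ℕ→ℚ 2 * b → u ≡ b - ½ * Y
    solve-for-last Y u b eq = begin
      u                               ≡⟨ isolate Y u ⟩
      ½ * (Y + 1ℚ * u + u) - ½ * Y    ≡⟨ cong (λ z → ½ * z - ½ * Y) eq ⟩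
      ½ * (ℕ→ℚ 2 * b) - ½ * Y         ≡⟨ halve b Y ⟩
      b - ½ * Y                       ∎
      where
      open ≡-Reasoning
      isolate : ∀ Y u → u ≡ ½ * (Y + 1ℚ * u + u) - ½ * Y
      isolate = solve-∀ ℚ-ring
      halve : ∀ b Y → ½ * (ℕ→ℚ 2 * b) - ½ * Y ≡ b - ½ * Y
      halve = solve-∀ ℚ-ring

    nextEulerPoly-values : ∀ n → nextEulerPoly n (values n) ≡ U (suc n)
    nextEulerPoly-values n =
      trans (cong (λ s → (x ^q suc n) - ½ * s) sum-values)
            (sym (solve-for-last Y (U (suc n)) (x ^q suc n) last-recurrence))
      where
      Y = sumTo n (λ m → ℕ→ℚ (suc n C m) * U m)
      last-recurrence : Y + 1ℚ * U (suc n) + U (suc n) ≡ ℕ→ℚ 2 * (x ^q suc n)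
      last-recurrence =
        trans (cong (λ c → Y + ℕ→ℚ c * U (suc n) + U (suc n)) (sym (nCn≡1 (suc n))))
              (recurrence (suc n))
      sum-values : sumFin (suc n) (λ k → ℕ→ℚ (suc n C toℕ k) * lookup (values n) k) ≡ Y
      sum-values =
        trans (sumFin-cong (suc n) (λ k → cong (ℕ→ℚ (suc n C toℕ k) *_)
                                               (lookup∘tabulate (U ∘ toℕ) k)))
              (sumFin≡sumTo n (λ m → ℕ→ℚ (suc n C m) * U m))

    eulerPolys≡values : ∀ n → eulerPolys x n ≡ values n
    eulerPolys≡values zero =
      cong (_∷ []) (sym (solve-for-last 0ℚ (U 0) 1ℚ (trans (cong (_+ U 0) (+-identityˡ (1ℚ * U 0)))
                                                           (recurrence 0))))
    eulerPolys≡values (suc n) = begin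
      eulerPolys x n ∷ʳ nextEulerPoly n (eulerPolys x n)
        ≡⟨ cong (λ v → v ∷ʳ nextEulerPoly n v) (eulerPolys≡values n) ⟩
      values n ∷ʳ nextEulerPoly n (values n)
        ≡⟨ cong (values n ∷ʳ_) (nextEulerPoly-values n) ⟩
      values n ∷ʳ U (suc n)
        ≡⟨ cong₂ _∷ʳ_ (tabulate-cong (cong U ∘ sym ∘ toℕ-inject₁))
                      (cong U (sym (toℕ-fromℕ (suc n)))) ⟩
      tabulate (U ∘ toℕ ∘ inject₁) ∷ʳ U (toℕ (fromℕ (suc n)))
        ≡⟨ tabulate-∷ʳ (suc n) (U ∘ toℕ) ⟨
      values (suc n)
        ∎
      where open ≡-Reasoning

  eulerPoly-unique : ∀ n → eulerPoly n x ≡ U n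
  eulerPoly-unique n = begin
    lookup (eulerPolys x n) (fromℕ n)    ≡⟨ cong (λ v → lookup v (fromℕ n)) (eulerPolys≡values n) ⟩
    lookup (values n) (fromℕ n)          ≡⟨ lookup∘tabulate (U ∘ toℕ) (fromℕ n) ⟩
    U (toℕ (fromℕ n))                    ≡⟨ cong U (toℕ-fromℕ n) ⟩
    U n                                  ∎
    where open ≡-Reasoning

eulerPoly≡stirlingTransform : ∀ x A →
  (∀ k → mulOnePlusU A k + A k ≡ ℕ→ℚ 2 * fallingFactorial x k) →
  ∀ n → eulerPoly n x ≡ stirlingTransform n A
eulerPoly≡stirlingTransform x A generating n =
  trans (eulerPoly-unique x (λ m → D^ m A 0) recurrence n) (sym (stirlingTransform≡D^ n A))
  where
  recurrence : EulerRecurrence x (λ m → D^ m A 0)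
  recurrence n = begin
    binomialSum n (λ m → D^ m A 0) + D^ n A 0      ≡⟨ cong (_+ D^ n A 0) (binomialSum-D^ n A) ⟩
    D^ n (mulOnePlusU A) 0 + D^ n A 0              ≡⟨ D^-+ n (mulOnePlusU A) A 0 ⟨
    D^ n (λ k → mulOnePlusU A k + A k) 0           ≡⟨ D^-cong n generating 0 ⟩
    D^ n (λ k → ℕ→ℚ 2 * fallingFactorial x k) 0    ≡⟨ D^-*ˡ n (ℕ→ℚ 2) (fallingFactorial x) 0 ⟩
    ℕ→ℚ 2 * D^ n (fallingFactorial x) 0            ≡⟨ cong (ℕ→ℚ 2 *_) (D^-fallingFactorial n x 0) ⟩
    ℕ→ℚ 2 * ((x ^q n) * 1ℚ)                        ≡⟨ cong (ℕ→ℚ 2 *_) (*-identityʳ (x ^q n)) ⟩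
    ℕ→ℚ 2 * (x ^q n)                               ∎
    where open ≡-Reasoning

[k+1]*[n+1]C[k+1]≡[n+1]*nCk : ∀ n k → suc k ℕ.* (suc n C suc k) ≡ suc n ℕ.* (n C k)
[k+1]*[n+1]C[k+1]≡[n+1]*nCk zero    zero    = refl
[k+1]*[n+1]C[k+1]≡[n+1]*nCk zero    (suc k) =
  trans (cong (suc (suc k) ℕ.*_) (k>n⇒nCk≡0 {1} {suc (suc k)} (ℕ.s≤s (ℕ.s≤s ℕ.z≤n))))
        (ℕ.*-zeroʳ (suc (suc k)))
[k+1]*[n+1]C[k+1]≡[n+1]*nCk (suc n) zero    =
  trans (ℕ.+-identityʳ _) (trans (nC1≡n (suc (suc n))) (sym (ℕ.*-identityʳ (suc (suc n)))))
[k+1]*[n+1]C[k+1]≡[n+1]*nCk (suc n) (suc k) = begin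
  suc (suc k) ℕ.* (suc (suc n) C suc (suc k))
    ≡⟨ cong (suc (suc k) ℕ.*_) (nCk+nC[k+1]≡[n+1]C[k+1] (suc n) (suc k)) ⟨
  suc (suc k) ℕ.* (X ℕ.+ Y)
    ≡⟨ split k X Y ⟩
  suc k ℕ.* X ℕ.+ X ℕ.+ suc (suc k) ℕ.* Y
    ≡⟨ cong₂ (λ a b → a ℕ.+ X ℕ.+ b) ([k+1]*[n+1]C[k+1]≡[n+1]*nCk n k)
                                      ([k+1]*[n+1]C[k+1]≡[n+1]*nCk n (suc k)) ⟩
  suc n ℕ.* (n C k) ℕ.+ X ℕ.+ suc n ℕ.* (n C suc k)
    ≡⟨ regroup n (n C k) X (n C suc k) ⟩
  suc n ℕ.* (n C k ℕ.+ n C suc k) ℕ.+ X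
    ≡⟨ cong (λ z → suc n ℕ.* z ℕ.+ X) (nCk+nC[k+1]≡[n+1]C[k+1] n k) ⟩
  suc n ℕ.* X ℕ.+ X
    ≡⟨ ℕ.+-comm (suc n ℕ.* X) X ⟩
  suc (suc n) ℕ.* X
    ∎
  where
  open ≡-Reasoning
  X = suc n C suc k
  Y = suc n C suc (suc k)
  split : ∀ k x y → suc (suc k) ℕ.* (x ℕ.+ y) ≡ suc k ℕ.* x ℕ.+ x ℕ.+ suc (suc k) ℕ.* y
  split = ℕ-Solver.solve-∀
  regroup : ∀ n a x b → suc n ℕ.* a ℕ.+ x ℕ.+ suc n ℕ.* b ≡ suc n ℕ.* (a ℕ.+ b) ℕ.+ x
  regroup = ℕ-Solver.solve-∀

centralBinomial-suc : ∀ i →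
  suc i ℕ.* ((2 ℕ.* suc i) C suc i) ≡ 2 ℕ.* suc (i ℕ.+ i) ℕ.* ((2 ℕ.* i) C i)
centralBinomial-suc i = begin
  suc i ℕ.* ((2 ℕ.* suc i) C suc i)
    ≡⟨ cong (λ m → suc i ℕ.* (m C suc i)) (2[1+i]≡2+i+i i) ⟩
  suc i ℕ.* (suc (suc (i ℕ.+ i)) C suc i)
    ≡⟨ cong (suc i ℕ.*_) (nCk+nC[k+1]≡[n+1]C[k+1] (suc (i ℕ.+ i)) i) ⟨
  suc i ℕ.* (suc (i ℕ.+ i) C i ℕ.+ X)
    ≡⟨ cong (λ z → suc i ℕ.* (z ℕ.+ X)) symmetric ⟩
  suc i ℕ.* (X ℕ.+ X)
    ≡⟨ double i X ⟩
  2 ℕ.* (suc i ℕ.* X)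
    ≡⟨ cong (2 ℕ.*_) ([k+1]*[n+1]C[k+1]≡[n+1]*nCk (i ℕ.+ i) i) ⟩
  2 ℕ.* (suc (i ℕ.+ i) ℕ.* ((i ℕ.+ i) C i))
    ≡⟨ cong (λ m → 2 ℕ.* (suc (i ℕ.+ i) ℕ.* (m C i))) (2i≡i+i i) ⟨
  2 ℕ.* (suc (i ℕ.+ i) ℕ.* ((2 ℕ.* i) C i))
    ≡⟨ ℕ.*-assoc 2 (suc (i ℕ.+ i)) _ ⟨
  2 ℕ.* suc (i ℕ.+ i) ℕ.* ((2 ℕ.* i) C i)
    ∎
  where
  open ≡-Reasoning
  X = suc (i ℕ.+ i) C suc i
  2[1+i]≡2+i+i : ∀ i → 2 ℕ.* suc i ≡ suc (suc (i ℕ.+ i))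
  2[1+i]≡2+i+i = ℕ-Solver.solve-∀
  2i≡i+i : ∀ i → 2 ℕ.* i ≡ i ℕ.+ i
  2i≡i+i = ℕ-Solver.solve-∀
  double : ∀ i x → suc i ℕ.* (x ℕ.+ x) ≡ 2 ℕ.* (suc i ℕ.* x)
  double = ℕ-Solver.solve-∀
  symmetric : suc (i ℕ.+ i) C i ≡ X
  symmetric = trans (nCk≡nC[n∸k] (ℕ.m≤n⇒m≤1+n (ℕ.m≤m+n i i)))
                    (cong (suc (i ℕ.+ i) C_) (ℕ.m+n∸n≡m (suc i) i))

inv1m2j-inverse : ∀ i → ℕ→ℚ (suc (i ℕ.+ i)) * inv1m2j (suc i) ≡ - 1ℚ
inv1m2j-inverse i = begin
  ℕ→ℚ (suc m) * (- normalize 1 (suc m))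
    ≡⟨ cong₂ (λ a b → a * (- b)) (normalize-coprime (Coprime.sym (Coprime.1-coprimeTo (suc m))))
                                 (normalize-coprime (Coprime.1-coprimeTo (suc m))) ⟩
  Q * (- (1/ Q))
    ≡⟨ neg-distribʳ-* Q (1/ Q) ⟨
  - (Q * (1/ Q))
    ≡⟨ cong -_ (*-inverseʳ Q) ⟩
  - 1ℚ
    ∎
  where
  open ≡-Reasoning
  m = i ℕ.+ i
  Q = mkℚ (ℤ.+ suc m) 0 (Coprime.sym (Coprime.1-coprimeTo (suc m)))

^q-+ : ∀ x m n → x ^q (m ℕ.+ n) ≡ (x ^q m) * (x ^q n)
^q-+ x zero    n = sym (*-identityˡ (x ^q n))
^q-+ x (suc m) n = trans (cong (x *_) (^q-+ x m n)) (sym (*-assoc x (x ^q m) (x ^q n)))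

-- centralTerm j = C(2j,j) / (2ʲ (1 − 2j)) = (−2)ʲ C(½,j).
centralTerm : ℕ → ℚ
centralTerm j = ℕ→ℚ ((2 ℕ.* j) C j) * (½ ^q j) * inv1m2j j

term≡½^k*centralTerm : ∀ k j → term k j ≡ (½ ^q k) * centralTerm j
term≡½^k*centralTerm k j =
  trans (cong (λ h → ℕ→ℚ ((2 ℕ.* j) C j) * h * inv1m2j j) (^q-+ ½ k j))
        (reassociate (ℕ→ℚ ((2 ℕ.* j) C j)) (½ ^q k) (½ ^q j) (inv1m2j j))
  where
  reassociate : ∀ c h g w → c * (h * g) * w ≡ h * (c * g * w)
  reassociate = solve-∀ ℚ-ring

centralTerm-suc : ∀ i →
  ℕ→ℚ (suc i) * (- ½) * centralTerm (suc i) ≡ ½ * ℕ→ℚ ((2 ℕ.* i) C i) * (½ ^q i)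
centralTerm-suc i = begin
  a * (- ½) * (c′ * (½ * h) * w)          ≡⟨ reassociate a c′ h w ⟩
  (- ½) * ½ * (a * c′) * h * w            ≡⟨ cong (λ z → (- ½) * ½ * z * h * w) absorb ⟩
  (- ½) * ½ * (ℕ→ℚ 2 * e * c) * h * w    ≡⟨ regroup e c h w ⟩
  (- ½) * c * h * (e * w)                 ≡⟨ cong ((- ½) * c * h *_) (inv1m2j-inverse i) ⟩
  (- ½) * c * h * (- 1ℚ)                  ≡⟨ negate c h ⟩
  ½ * c * h                               ∎
  where
  open ≡-Reasoning
  a = ℕ→ℚ (suc i)
  c′ = ℕ→ℚ ((2 ℕ.* suc i) C suc i)
  c = ℕ→ℚ ((2 ℕ.* i) C i)
  e = ℕ→ℚ (suc (i ℕ.+ i))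
  h = ½ ^q i
  w = inv1m2j (suc i)
  absorb : a * c′ ≡ ℕ→ℚ 2 * e * c
  absorb = begin
    a * c′
      ≡⟨ ℕ→ℚ-* (suc i) ((2 ℕ.* suc i) C suc i) ⟨
    ℕ→ℚ (suc i ℕ.* ((2 ℕ.* suc i) C suc i))
      ≡⟨ cong ℕ→ℚ (centralBinomial-suc i) ⟩
    ℕ→ℚ (2 ℕ.* suc (i ℕ.+ i) ℕ.* ((2 ℕ.* i) C i))
      ≡⟨ ℕ→ℚ-* (2 ℕ.* suc (i ℕ.+ i)) ((2 ℕ.* i) C i) ⟩
    ℕ→ℚ (2 ℕ.* suc (i ℕ.+ i)) * c
      ≡⟨ cong (_* c) (ℕ→ℚ-* 2 (suc (i ℕ.+ i))) ⟩
    ℕ→ℚ 2 * e * c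
      ∎
  reassociate : ∀ a c′ h w → a * (- ½) * (c′ * (½ * h) * w) ≡ (- ½) * ½ * (a * c′) * h * w
  reassociate = solve-∀ ℚ-ring
  regroup : ∀ e c h w → (- ½) * ½ * (ℕ→ℚ 2 * e * c) * h * w ≡ (- ½) * c * h * (e * w)
  regroup = solve-∀ ℚ-ring
  negate : ∀ c h → (- ½) * c * h * (- 1ℚ) ≡ ½ * c * h
  negate = solve-∀ ℚ-ring

centralTerm*[½-j] : ∀ j → centralTerm j * (½ - ℕ→ℚ j) ≡ ½ * ℕ→ℚ ((2 ℕ.* j) C j) * (½ ^q j)
centralTerm*[½-j] zero    = refl
centralTerm*[½-j] (suc i) = begin
  c * h * w * (½ - ℕ→ℚ (suc i))               ≡⟨ cong (λ z → c * h * w * (½ - z)) (ℕ→ℚ-suc i) ⟩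
  c * h * w * (½ - (1ℚ + b))                  ≡⟨ regroup c h w b ⟩
  (- ½) * c * h * ((1ℚ + (b + b)) * w)        ≡⟨ cong (λ z → (- ½) * c * h * (z * w)) 1+2i ⟨
  (- ½) * c * h * (ℕ→ℚ (suc (i ℕ.+ i)) * w)   ≡⟨ cong ((- ½) * c * h *_) (inv1m2j-inverse i) ⟩
  (- ½) * c * h * (- 1ℚ)                      ≡⟨ negate c h ⟩
  ½ * c * h                                   ∎
  where
  open ≡-Reasoning
  c = ℕ→ℚ ((2 ℕ.* suc i) C suc i)
  h = ½ ^q suc i
  w = inv1m2j (suc i)
  b = ℕ→ℚ i
  1+2i : ℕ→ℚ (suc (i ℕ.+ i)) ≡ 1ℚ + (b + b)
  1+2i = trans (ℕ→ℚ-suc (i ℕ.+ i)) (cong (1ℚ +_) (ℕ→ℚ-+ i i))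
  regroup : ∀ c h w b → c * h * w * (½ - (1ℚ + b)) ≡ (- ½) * c * h * ((1ℚ + (b + b)) * w)
  regroup = solve-∀ ℚ-ring
  negate : ∀ c h → (- ½) * c * h * (- 1ℚ) ≡ ½ * c * h
  negate = solve-∀ ℚ-ring

centralTerm-recurrence : ∀ i →
  ℕ→ℚ (suc i) * (- ½) * centralTerm (suc i) ≡ centralTerm i * (½ - ℕ→ℚ i)
centralTerm-recurrence i = trans (centralTerm-suc i) (sym (centralTerm*[½-j] i))

factorialNegHalfPower : ℕ → ℚ
factorialNegHalfPower k = ℕ→ℚ (k !) * sgn k * (½ ^q k)

factorialNegHalfPower-suc : ∀ k →
  factorialNegHalfPower (suc k) ≡ ℕ→ℚ (suc k) * factorialNegHalfPower k * (- ½)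
factorialNegHalfPower-suc k =
  trans (cong (λ f → f * ((- 1ℚ) * sgn k) * (½ * (½ ^q k))) (ℕ→ℚ-* (suc k) (k !)))
        (regroup (ℕ→ℚ (suc k)) (ℕ→ℚ (k !)) (sgn k) (½ ^q k))
  where
  regroup : ∀ a f s h → a * f * ((- 1ℚ) * s) * (½ * h) ≡ a * (f * s * h) * (- ½)
  regroup = solve-∀ ℚ-ring

fallingFactorial-½ : ∀ k → fallingFactorial ½ k ≡ factorialNegHalfPower k * centralTerm k
fallingFactorial-½ zero    = refl
fallingFactorial-½ (suc i) = begin
  fallingFactorial ½ i * (½ - ℕ→ℚ i)        ≡⟨ cong (_* (½ - ℕ→ℚ i)) (fallingFactorial-½ i) ⟩
  P i * c i * (½ - ℕ→ℚ i)                   ≡⟨ *-assoc (P i) (c i) _ ⟩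
  P i * (c i * (½ - ℕ→ℚ i))                 ≡⟨ cong (P i *_) (centralTerm-recurrence i) ⟨
  P i * (ℕ→ℚ (suc i) * (- ½) * c (suc i))   ≡⟨ regroup (P i) (ℕ→ℚ (suc i)) (c (suc i)) ⟩
  ℕ→ℚ (suc i) * P i * (- ½) * c (suc i)     ≡⟨ cong (_* c (suc i)) (factorialNegHalfPower-suc i) ⟨
  P (suc i) * c (suc i)                     ∎
  where
  open ≡-Reasoning
  P = factorialNegHalfPower
  c = centralTerm
  regroup : ∀ p a x → p * (a * (- ½) * x) ≡ a * p * (- ½) * x
  regroup = solve-∀ ℚ-ring

stirlingCoefficient : ℕ → ℚ
stirlingCoefficient k = ℕ→ℚ (k !) * sgn k * sumTo k (term k)

stirlingCoefficient≡ : ∀ k → stirlingCoefficient k ≡ factorialNegHalfPower k * sumTo k centralTerm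
stirlingCoefficient≡ k = begin
  ℕ→ℚ (k !) * sgn k * sumTo k (term k)
    ≡⟨ cong (ℕ→ℚ (k !) * sgn k *_) (sumTo-cong k (term≡½^k*centralTerm k)) ⟩
  ℕ→ℚ (k !) * sgn k * sumTo k (λ j → (½ ^q k) * centralTerm j)
    ≡⟨ cong (ℕ→ℚ (k !) * sgn k *_) (*-distribˡ-sumTo k (½ ^q k) centralTerm) ⟩
  ℕ→ℚ (k !) * sgn k * ((½ ^q k) * sumTo k centralTerm)
    ≡⟨ *-assoc (ℕ→ℚ (k !) * sgn k) (½ ^q k) (sumTo k centralTerm) ⟨
  factorialNegHalfPower k * sumTo k centralTerm
    ∎
  where open ≡-Reasoning

-- Coefficientwise, (2 + u) g(u) = 2 √(1 + u) for g(u) = Σₖ stirlingCoefficient k uᵏ/k!.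
stirlingCoefficient-generating : ∀ k → mulOnePlusU stirlingCoefficient k + stirlingCoefficient k
                                       ≡ ℕ→ℚ 2 * fallingFactorial ½ k
stirlingCoefficient-generating zero    = refl
stirlingCoefficient-generating (suc k) = begin
  A (suc k) + a * A k + A (suc k)
    ≡⟨ cong₂ (λ y z → y + a * z + y) A[1+k] (stirlingCoefficient≡ k) ⟩
  X + a * (P k * T) + X
    ≡⟨ telescope a (P k) T (centralTerm (suc k)) ⟩
  ℕ→ℚ 2 * ((a * P k * (- ½)) * centralTerm (suc k))
    ≡⟨ cong (λ z → ℕ→ℚ 2 * (z * centralTerm (suc k))) (factorialNegHalfPower-suc k) ⟨
  ℕ→ℚ 2 * (P (suc k) * centralTerm (suc k))
    ≡⟨ cong (ℕ→ℚ 2 *_) (fallingFactorial-½ (suc k)) ⟨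
  ℕ→ℚ 2 * fallingFactorial ½ (suc k)
    ∎
  where
  open ≡-Reasoning
  A = stirlingCoefficient
  P = factorialNegHalfPower
  a = ℕ→ℚ (suc k)
  T = sumTo k centralTerm
  X = (a * P k * (- ½)) * (T + centralTerm (suc k))
  A[1+k] : A (suc k) ≡ X
  A[1+k] = trans (stirlingCoefficient≡ (suc k))
                 (cong (_* (T + centralTerm (suc k))) (factorialNegHalfPower-suc k))
  telescope : ∀ a p s x → (a * p * (- ½)) * (s + x) + a * (p * s) + (a * p * (- ½)) * (s + x)
                        ≡ ℕ→ℚ 2 * ((a * p * (- ½)) * x)
  telescope = solve-∀ ℚ-ring

mainTheorem4 : (n : ℕ) → E n ≡ sumTo n (λ k → ℕ→ℚ (S n k) * ℕ→ℚ (k !) * sgn k * sumTo k (λ j → term k j))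
mainTheorem4 n = begin
  eulerPoly n ½
    ≡⟨ eulerPoly≡stirlingTransform ½ stirlingCoefficient stirlingCoefficient-generating n ⟩
  stirlingTransform n stirlingCoefficient
    ≡⟨ sumTo-cong n (λ k → reassociate (ℕ→ℚ (S n k)) (ℕ→ℚ (k !)) (sgn k) (sumTo k (term k))) ⟩
  sumTo n (λ k → ℕ→ℚ (S n k) * ℕ→ℚ (k !) * sgn k * sumTo k (λ j → term k j))
    ∎
  where
  open ≡-Reasoning
  reassociate : ∀ s f σ t → s * (f * σ * t) ≡ s * f * σ * t
  reassociate = solve-∀ ℚ-ring
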